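{- Let $n\ge5$ be prime and $s=(s_1,\dots,s_n)\in(\mathbb{Z}/n\mathbb{Z})^n$ with $\sum s_i=0$, and assume $s$ is not constant (i.e. its class modulo the simultaneous actions of $\mathbb{Z}/n\mathbb{Z}$, $\mathfrak{S}_n$, $(\mathbb{Z}/n\mathbb{Z})^\times$ is not that of $(0,\dots,0)$). Then $K(s)$ divides the number $[\mathfrak{S}_n:\overline{S}_s]$ of distinct permutations of $[s]$. If moreover the class of $s$ modulo $\mathbb{Z}/n\mathbb{Z}$ and $\mathfrak{S}_n$ is not that of $(0,1,2,\dots,n-1)$, then $K(s)$ divides $\gamma(s)$, and $\gamma(s)=[\mathfrak{S}_n:S'_s]=[\mathfrak{S}_n:\overline{S}_s]$.
   Context: Actions on tuples with coordinate sum $0$: $j\in\mathbb{Z}/n\mathbb{Z}$ adds $j$ to each coordinate; $k\in(\mathbb{Z}/n\mathbb{Z})^\times$ multiplies each coordinate by $k$; $\sigma\in\mathfrak{S}_n$ acts by ${}^\sigma(s_1,\dots,s_n)=(s_{\sigma^{ -1}(1)},\dots,s_{\sigma^{ -1}(n)})$. $[s]$ is the orbit of $s$ under $\mathbb{Z}/n\mathbb{Z}$. Subgroups: $S'_s=\{\sigma\in\mathfrak{S}_n:{}^\sigma s=s\}$, $\overline{S}_s=\{\sigma\in\mathfrak{S}_n:[{}^\sigma s]=[s]\}$. $\gamma(s)$ is the number of distinct permutations of $(s_1,\dots,s_n)$. $K(s)=\#\{k\in(\mathbb{Z}/n\mathbb{Z})^\times : [ks]=[{}^\sigma s]\text{ for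 some }\sigma\in\mathfrak{S}_n\}$. -}

module Defs where

open import Data.Nat using (ℕ; zero; suc; _+_; _*_; _!; NonZero)
open import Data.Nat.DivMod using (_mod_; _/_)
open import Data.Fin using (Fin; toℕ)
import Data.Fin
open import Data.Fin.Permutation using (Permutation′; _⟨$⟩ʳ_; _⟨$⟩ˡ_)
open import Data.List using (List)
open import Data.List.Relation.Unary.All using (All)
open import Data.List.Relation.Unary.Any using (Any)
open import Data.List.Relation.Unary.AllPairs using (AllPairs)
open import Data.Product using (Σ; ∃; ∃-syntax; _×_)
open import Relation.Nullary using (¬_)
open import Relation.Binary.PropositionalEquality using (_≡_; _≗_)

-- Finite cardinalities, up to a chosen equality.
-- `Enumerates _≈_ P L` : the list L contains exactly the elements
-- satisfying P, each exactly once up to _≈_.  Then `length L` is the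
-- number of (≈-distinct) elements satisfying P.

record Enumerates {A : Set} (_≈_ : A → A → Set) (P : A → Set) (L : List A) : Set where
  field
    sound    : All P L
    complete : ∀ x → P x → Any (x ≈_) L
    distinct : AllPairs (λ a b → ¬ (a ≈ b)) L

module ZMod (n : ℕ) .{{_ : NonZero n}} where

  _+ₙ_ : Fin n → Fin n → Fin n
  a +ₙ b = (toℕ a + toℕ b) mod n

  _*ₙ_ : Fin n → Fin n → Fin n
  a *ₙ b = (toℕ a * toℕ b) mod n

  oneₙ : Fin n
  oneₙ = 1 mod n

  IsUnit : Fin n → Set
  IsUnit k = ∃[ k′ ] (k *ₙ k′ ≡ oneₙ)

  Tuple : Set
  Tuple = Fin n → Fin n

  sumℕ : ∀ {m} → (Fin m → ℕ) → ℕ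
  sumℕ {zero}  f = 0
  sumℕ {suc m} f = f Data.Fin.zero + sumℕ (λ i → f (Data.Fin.suc i))

  SumZero : Tuple → Set
  SumZero s = sumℕ (λ i → toℕ (s i)) mod n ≡ 0 mod n

  shift : Fin n → Tuple → Tuple
  shift j s i = s i +ₙ j

  scale : Fin n → Tuple → Tuple
  scale k s i = k *ₙ s i

  act : Permutation′ n → Tuple → Tuple
  act σ s i = s (σ ⟨$⟩ˡ i)

  _≈ₚ_ : Permutation′ n → Permutation′ n → Set
  σ ≈ₚ τ = ∀ i → σ ⟨$⟩ʳ i ≡ τ ⟨$⟩ʳ i

  SameClass : Tuple → Tuple → Set
  SameClass t s = ∃[ j ] (t ≗ shift j s)

  InS′ : Tuple → Permutation′ n → Set
  InS′ s σ = act σ s ≗ s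

  InSbar : Tuple → Permutation′ n → Set
  InSbar s σ = SameClass (act σ s) s

  -- t is a permutation of s (elements counted by γ(s))
  IsPermOf : Tuple → Tuple → Set
  IsPermOf s t = ∃[ σ ] (t ≗ act σ s)

  InK : Tuple → Fin n → Set
  InK s k = IsUnit k × ∃[ σ ] SameClass (scale k s) (act σ s)

  -- s is constant (class of (0,…,0) under all the actions)
  Constant : Tuple → Set
  Constant s = ∃[ c ] (∀ i → s i ≡ c)

  ClassOfId : Tuple → Set
  ClassOfId s = ∃[ σ ] SameClass s (act σ (λ i → i))

-- index [𝔖ₙ : H] = n! / |H|  (|H| ≥ 1 always; the value for 0 is a dummy)
index : ℕ → ℕ → ℕ
index N zero    = 0
index N (suc h) = N / suc h

module Submission where

open import Defs
open import Data.Nat using (ℕ; suc; _≤_; _!; NonZero)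
open import Data.Nat.Divisibility using (_∣_)
open import Data.Nat.Primality using (Prime)
open import Data.Fin using (Fin)
open import Data.Fin.Permutation using (Permutation′)
open import Data.List using (List; length)
open import Data.Product using (_×_)
open import Relation.Nullary using (¬_)
open import Relation.Binary.PropositionalEquality using (_≡_; _≗_)

-- The proof is by counting.
--  * Orbit–stabiliser for 𝔖ₙ, applied to σ ↦ σs and to σ ↦ [σs], gives
--    n! = γ(s)·|S′ₛ| and n! = #{[σs]}·|S̄ₛ|, so [𝔖ₙ : S̄ₛ] is the number of classes [σs].
--  * K(s) is a subgroup of (ℤ/nℤ)^× acting on these classes by scaling; since s is
--    not constant and n is prime the action is free, so each orbit has |K(s)|
--    elements and |K(s)| divides #{[σs]} = [𝔖ₙ : S̄ₛ].
--  * If σs = s + j with j ≠ 0, then s runs through s₀, s₀ + j, s₀ + 2j, … along the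
--    orbit of 0 under σ⁻¹, hence takes all n values: s is of the class of (0,1,…,n−1).
--    Otherwise S̄ₛ = S′ₛ, whence γ(s) = [𝔖ₙ : S′ₛ] = [𝔖ₙ : S̄ₛ] and |K(s)| ∣ γ(s).

-- Sizes of finite sets given by enumerations, up to a setoid equality.
module Counting where

  open import Level using (0ℓ)
  open import Data.Nat using (ℕ; suc; _+_; _*_; _≤_; z≤n; s≤s)
  open import Data.Nat.Properties using (≤-antisym; +-suc)
  open import Data.Empty using (⊥-elim)
  open import Data.List using (List; []; _∷_; length; map; filter; deduplicate; cartesianProduct)
  open import Data.List.Properties using (length-map; length-++; length-removeAt′)
  open import Data.List.Relation.Unary.All as All using (All; []; _∷_)
  import Data.List.Relation.Unary.All.Properties as All
  open import Data.List.Relation.Unary.Any as Any using (Any; here; there; _─_)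
  import Data.List.Relation.Unary.Any.Properties as Any
  open import Data.List.Relation.Unary.AllPairs using (_∷_)
  import Data.List.Membership.Setoid as Membership
  import Data.List.Membership.Setoid.Properties as ∈
  import Data.List.Relation.Unary.Unique.Setoid as Unique
  import Data.List.Relation.Unary.Unique.Setoid.Properties as UniqueP
  import Data.List.Relation.Unary.Unique.DecSetoid.Properties as UniqueDP
  open import Data.Product using (Σ-syntax; ∃-syntax; _×_; _,_)
  open import Data.Product.Relation.Binary.Pointwise.NonDependent using (_×ₛ_)
  open import Relation.Nullary using (¬_; yes; no)
  open import Relation.Unary using (Decidable)
  open import Relation.Unary.Properties using (∁?)
  open import Relation.Binary using (Setoid; DecSetoid)
  open import Relation.Binary.PropositionalEquality as ≡ using (_≡_; refl; cong)

  HasSize : (S : Setoid 0ℓ 0ℓ) → (Setoid.Carrier S → Set) → ℕ → Set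
  HasSize S P c = Σ[ L ∈ List (Setoid.Carrier S) ] Enumerates (Setoid._≈_ S) P L × (length L ≡ c)

  length-cartesianProduct : ∀ {A B : Set} (xs : List A) (ys : List B) →
                            length (cartesianProduct xs ys) ≡ length xs * length ys
  length-cartesianProduct []       ys = refl
  length-cartesianProduct (x ∷ xs) ys = ≡.trans (length-++ (map (x ,_) ys))
    (≡.cong₂ _+_ (length-map (x ,_) ys) (length-cartesianProduct xs ys))

  module _ (S : Setoid 0ℓ 0ℓ) where
    open Setoid S using (_≈_; sym; trans) renaming (Carrier to A)
    open Membership S using (_∈_)
    open Unique S using (Unique)

    ∈-─ : ∀ {x y ys} (y∈ : y ∈ ys) → x ∈ ys → ¬ x ≈ y → x ∈ (ys ─ y∈)
    ∈-─ (here y≈z) (here x≈z) x≉y = ⊥-elim (x≉y (trans x≈z (sym y≈z)))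
    ∈-─ (here _)   (there x∈) _   = x∈
    ∈-─ (there _)  (here x≈z) _   = here x≈z
    ∈-─ (there y∈) (there x∈) x≉y = there (∈-─ y∈ x∈ x≉y)

    unique-⊆-length : ∀ {xs ys} → Unique xs → All (_∈ ys) xs → length xs ≤ length ys
    unique-⊆-length {[]}         _            _            = z≤n
    unique-⊆-length {x ∷ xs} {ys} (x∉ ∷ xs!) (x∈ ∷ xs⊆) =
      ≡.subst (suc (length xs) ≤_) (≡.sym (length-removeAt′ ys (Any.index x∈)))
        (s≤s (unique-⊆-length xs! (survive xs⊆ x∉)))
      where
      survive : ∀ {zs} → All (_∈ ys) zs → All (λ z → ¬ x ≈ z) zs → All (_∈ (ys ─ x∈)) zs
      survive []           []           = []
      survive (z∈ ∷ zs⊆) (x≉z ∷ x≉zs) = ∈-─ x∈ z∈ (λ z≈x → x≉z (sym z≈x)) ∷ survive zs⊆ x≉zs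

    enumeration-≤ : ∀ {P Q : A → Set} {xs ys} → Enumerates _≈_ P xs → Enumerates _≈_ Q ys →
                    (∀ x → P x → Q x) → length xs ≤ length ys
    enumeration-≤ eP eQ P⊆Q = unique-⊆-length (Enumerates.distinct eP)
      (All.map (λ {x} px → Enumerates.complete eQ x (P⊆Q x px)) (Enumerates.sound eP))

    enumeration-size : ∀ {P : A → Set} {xs c} → HasSize S P c → Enumerates _≈_ P xs → length xs ≡ c
    enumeration-size (ys , eP′ , refl) eP =
      ≤-antisym (enumeration-≤ eP eP′ (λ _ p → p)) (enumeration-≤ eP′ eP (λ _ p → p))

    HasSize-⇔ : ∀ {P Q : A → Set} {c} → (∀ x → P x → Q x) → (∀ x → Q x → P x) → HasSize S P c → HasSize S Q c
    HasSize-⇔ P⇒Q Q⇒P (L , e , |L|) = L , record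
      { sound    = All.map (λ {x} → P⇒Q x) (Enumerates.sound e)
      ; complete = λ x qx → Enumerates.complete e x (Q⇒P x qx)
      ; distinct = Enumerates.distinct e } , |L|

    enumerates-filter : ∀ {P Q : A → Set} {xs} (Q? : Decidable Q) → (∀ {x y} → x ≈ y → Q x → Q y) →
                        Enumerates _≈_ P xs → Enumerates _≈_ (λ x → P x × Q x) (filter Q? xs)
    enumerates-filter {xs = xs} Q? Q-resp e = record
      { sound    = All.zip (All.filter⁺ Q? (Enumerates.sound e) , All.all-filter Q? xs)
      ; complete = λ x (px , qx) → ∈.∈-filter⁺ S Q? Q-resp (Enumerates.complete e x px) qx
      ; distinct = UniqueP.filter⁺ S Q? (Enumerates.distinct e) }

    length-filter-split : ∀ {Q : A → Set} (Q? : Decidable Q) xs →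
                          length (filter Q? xs) + length (filter (∁? Q?) xs) ≡ length xs
    length-filter-split Q? []       = refl
    length-filter-split Q? (x ∷ xs) with Q? x
    ... | yes _ = cong suc (length-filter-split Q? xs)
    ... | no  _ = ≡.trans (+-suc _ _) (cong suc (length-filter-split Q? xs))

  module _ (S T : Setoid 0ℓ 0ℓ) where
    open Setoid S using () renaming (Carrier to A; _≈_ to _≈₁_)
    open Setoid T using () renaming (Carrier to B; _≈_ to _≈₂_)
    open Unique T using (Unique)

    enumerates-map : ∀ {P : A → Set} {Q : B → Set} {xs} (f : A → B) →
                     (∀ {x y} → x ≈₁ y → f x ≈₂ f y) → (∀ {x y} → f x ≈₂ f y → x ≈₁ y) →
                     (∀ x → P x → Q (f x)) → (∀ y → Q y → ∃[ x ] (P x × y ≈₂ f x)) →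
                     Enumerates _≈₁_ P xs → Enumerates _≈₂_ Q (map f xs)
    enumerates-map f f-cong f-inj P⇒Q Q⇒P e = record
      { sound    = All.map⁺ (All.map (λ {x} → P⇒Q x) (Enumerates.sound e))
      ; complete = λ y qy → let (x , px , y≈fx) = Q⇒P y qy in
          ∈.∈-resp-≈ T (Setoid.sym T y≈fx) (∈.∈-map⁺ S T f-cong (Enumerates.complete e x px))
      ; distinct = UniqueP.map⁺ S T f-inj (Enumerates.distinct e) }

    enumerates-product : ∀ {P : A → Set} {Q : B → Set} {xs ys} →
                         Enumerates _≈₁_ P xs → Enumerates _≈₂_ Q ys →
                         Enumerates (Setoid._≈_ (S ×ₛ T)) (λ (a , b) → P a × Q b) (cartesianProduct xs ys)
    enumerates-product {xs = xs} {ys} eP eQ = record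
      { sound    = All.cartesianProduct⁺ (≡.setoid A) (≡.setoid B) xs ys
                     (λ x∈ y∈ → All.lookup (Enumerates.sound eP) x∈ , All.lookup (Enumerates.sound eQ) y∈)
      ; complete = λ (a , b) (pa , qb) →
          ∈.∈-cartesianProduct⁺ S T (Enumerates.complete eP a pa) (Enumerates.complete eQ b qb)
      ; distinct = UniqueP.cartesianProduct⁺ S T (Enumerates.distinct eP) (Enumerates.distinct eQ) }

    double-counting : ∀ {P : A → Set} {L M} (E : A → B → Set) (E? : ∀ r → Decidable (λ x → E x r)) {c} →
                      (∀ {x y r} → x ≈₁ y → E x r → E y r) →
                      (∀ {x r r′} → E x r → E x r′ → r ≈₂ r′) →
                      Enumerates _≈₁_ P L → Unique M →
                      (∀ x → P x → Any (E x) M) →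
                      All (λ r → HasSize S (λ x → P x × E x r) c) M →
                      length L ≡ length M * c
    double-counting {L = []}    {[]} E E? E-resp E-fun eL M! cover sizes = refl
    double-counting {L = x ∷ L} {[]} E E? E-resp E-fun eL M! cover sizes with cover x (All.head (Enumerates.sound eL))
    ... | ()
    double-counting {P = P} {L} {r ∷ M} E E? {c} E-resp E-fun eL (r∉M ∷ M!) cover (size-r ∷ sizes) = begin
      length L                                        ≡⟨ ≡.sym (length-filter-split S (E? r) L) ⟩
      length (filter (E? r) L) + length (filter (∁? (E? r)) L)
                                                      ≡⟨ ≡.cong₂ _+_ over-r (double-counting E E? E-resp E-fun e-rest M! cover-rest sizes-rest) ⟩
      c + length M * c                                ∎
      where
      open ≡.≡-Reasoning
      over-r : length (filter (E? r) L) ≡ c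
      over-r = enumeration-size S size-r (enumerates-filter S (E? r) E-resp eL)
      e-rest : Enumerates _≈₁_ (λ x → P x × ¬ E x r) (filter (∁? (E? r)) L)
      e-rest = enumerates-filter S (∁? (E? r)) (λ x≈y ¬Exr Eyr → ¬Exr (E-resp (Setoid.sym S x≈y) Eyr)) eL
      cover-rest : ∀ x → P x × ¬ E x r → Any (E x) M
      cover-rest x (px , ¬Exr) with cover x px
      ... | here Exr = ⊥-elim (¬Exr Exr)
      ... | there E∈M = E∈M
      sizes-rest : All (λ r′ → HasSize S (λ x → (P x × ¬ E x r) × E x r′) c) M
      sizes-rest = All.zipWith (λ (r≉r′ , size-r′) → HasSize-⇔ S
          (λ x (px , Exr′) → (px , λ Exr → r≉r′ (E-fun Exr Exr′)) , Exr′)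
          (λ x ((px , _) , Exr′) → px , Exr′) size-r′) (r∉M , sizes)

  module _ (D : DecSetoid 0ℓ 0ℓ) where
    open DecSetoid D using (_≈_; _≟_; setoid) renaming (Carrier to A)
    open Membership setoid using (_∈_)

    enumerates-deduplicate : ∀ {P : A → Set} xs → All P xs → (∀ x → P x → x ∈ xs) →
                             Enumerates _≈_ P (deduplicate _≟_ xs)
    enumerates-deduplicate xs all-P covers = record
      { sound    = All.deduplicate⁺ _≟_ all-P
      ; complete = λ x px → Any.deduplicate⁺ _≟_ (λ y≈z x≈y → DecSetoid.trans D x≈y (DecSetoid.sym D y≈z)) (covers x px)
      ; distinct = UniqueDP.deduplicate-! D xs }

-- The symmetric group 𝔖ₖ: an explicit enumeration of its k! elements.
module Permutations where
  open import Level using (0ℓ)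
  open import Data.Nat using (ℕ; zero; suc; _*_; _!)
  open import Data.Nat.Properties using (n<1+n)
  open import Data.Empty using (⊥-elim)
  open import Data.Fin using (Fin; punchIn; punchOut) renaming (zero to 0F; suc to 1+)
  open import Data.Fin.Properties using (punchIn-injective; _≟_; any?; pigeonhole; punchOut-injective; <⇒≢)
  open import Relation.Nullary using (yes; no)
  open import Data.Fin.Permutation using (Permutation′; _⟨$⟩ʳ_; id; insert; remove; insert-punchIn; insert-remove)
    renaming (_≈_ to _≈ₚ_)
  open import Data.List using (List; []; _∷_; length; map; allFin; cartesianProduct)
  open import Data.List.Properties using (length-map; length-tabulate)
  open import Data.List.Relation.Unary.All as All using ([]; _∷_)
  open import Data.List.Relation.Unary.Any using (here)
  open import Data.List.Relation.Unary.AllPairs using ([]; _∷_)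
  open import Data.List.Membership.Propositional.Properties using (∈-allFin)
  open import Data.List.Relation.Unary.Unique.Propositional.Properties using (allFin⁺)
  open import Data.Product using (∃-syntax; _×_; _,_)
  open import Data.Product.Relation.Binary.Pointwise.NonDependent using (_×ₛ_)
  open import Data.Unit using (⊤; tt)
  open import Relation.Binary using (Setoid)
  open import Relation.Binary.PropositionalEquality as ≡ using (_≡_; refl; cong; cong₂)
  open Counting

  permSetoid : ℕ → Setoid 0ℓ 0ℓ
  permSetoid k = record
    { Carrier       = Permutation′ k
    ; _≈_           = _≈ₚ_
    ; isEquivalence = record
      { refl  = λ _ → refl
      ; sym   = λ σ≈τ i → ≡.sym (σ≈τ i)
      ; trans = λ σ≈τ τ≈ρ i → ≡.trans (σ≈τ i) (τ≈ρ i) } }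

  -- A permutation of 1+k points is its value at 0 together with a permutation of
  -- the remaining k points.
  insert₀ : ∀ {k} → Fin (suc k) × Permutation′ k → Permutation′ (suc k)
  insert₀ (j , π) = insert 0F j π

  insert₀-cong : ∀ {k} {x y : Fin (suc k) × Permutation′ k} →
                 Setoid._≈_ (≡.setoid (Fin (suc k)) ×ₛ permSetoid k) x y → insert₀ x ≈ₚ insert₀ y
  insert₀-cong (refl , π≈π′) 0F     = refl
  insert₀-cong {x = j , π} {_ , π′} (refl , π≈π′) (1+ i) = begin
    insert 0F j π ⟨$⟩ʳ 1+ i   ≡⟨ insert-punchIn 0F j π i ⟩
    punchIn j (π ⟨$⟩ʳ i)      ≡⟨ cong (punchIn j) (π≈π′ i) ⟩
    punchIn j (π′ ⟨$⟩ʳ i)     ≡⟨ ≡.sym (insert-punchIn 0F j π′ i) ⟩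
    insert 0F j π′ ⟨$⟩ʳ 1+ i  ∎
    where open ≡.≡-Reasoning

  insert₀-injective : ∀ {k} {x y : Fin (suc k) × Permutation′ k} →
                      insert₀ x ≈ₚ insert₀ y → Setoid._≈_ (≡.setoid (Fin (suc k)) ×ₛ permSetoid k) x y
  insert₀-injective {x = j , π} {j′ , π′} e with e 0F
  ... | refl = refl , λ i → punchIn-injective j _ _
        (≡.trans (≡.sym (insert-punchIn 0F j π i)) (≡.trans (e (1+ i)) (insert-punchIn 0F j π′ i)))

  allPerms : ∀ k → List (Permutation′ k)
  allPerms zero    = id ∷ []
  allPerms (suc k) = map insert₀ (cartesianProduct (allFin (suc k)) (allPerms k))

  allPerms-enumerates : ∀ k → Enumerates _≈ₚ_ (λ _ → ⊤) (allPerms k)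
  allPerms-enumerates zero    = record { sound = tt ∷ [] ; complete = λ _ _ → here (λ ()) ; distinct = [] ∷ [] }
  allPerms-enumerates (suc k) =
    enumerates-map (≡.setoid (Fin (suc k)) ×ₛ permSetoid k) (permSetoid (suc k)) insert₀
      insert₀-cong insert₀-injective (λ _ _ → tt)
      (λ σ _ → (σ ⟨$⟩ʳ 0F , remove 0F σ) , (tt , tt) , λ i → ≡.sym (insert-remove 0F σ i))
      (enumerates-product (≡.setoid (Fin (suc k))) (permSetoid k) allFin-enumerates (allPerms-enumerates k))
    where
    allFin-enumerates : Enumerates _≡_ (λ _ → ⊤) (allFin (suc k))
    allFin-enumerates = record
      { sound = All.universal (λ _ → tt) _ ; complete = λ i _ → ∈-allFin i ; distinct = allFin⁺ (suc k) }

  length-allPerms : ∀ k → length (allPerms k) ≡ k !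
  length-allPerms zero    = refl
  length-allPerms (suc k) = begin
    length (map insert₀ (cartesianProduct (allFin (suc k)) (allPerms k)))  ≡⟨ length-map insert₀ (cartesianProduct (allFin (suc k)) (allPerms k)) ⟩
    length (cartesianProduct (allFin (suc k)) (allPerms k))               ≡⟨ length-cartesianProduct (allFin (suc k)) (allPerms k) ⟩
    length (allFin (suc k)) * length (allPerms k)                         ≡⟨ cong₂ _*_ (length-tabulate {n = suc k} (λ i → i)) (length-allPerms k) ⟩
    suc k !                                                                ∎
    where open ≡.≡-Reasoning

  injective⇒surjective : ∀ {k} (f : Fin k → Fin k) → (∀ {a b} → f a ≡ f b → a ≡ b) → ∀ y → ∃[ x ] f x ≡ y
  injective⇒surjective {suc k} f f-inj y with any? (λ x → f x ≟ y)
  ... | yes hit = hit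
  ... | no miss with pigeonhole (n<1+n k) (λ x → punchOut {i = y} {j = f x} (λ y≡fx → miss (x , ≡.sym y≡fx)))
  ...   | a , b , a<b , e = ⊥-elim (<⇒≢ a<b (f-inj (punchOut-injective {i = y} _ _ e)))

-- Composition in 𝔖ₖ and the orbit–stabiliser theorem.
module OrbitStabiliser where
  open Counting
  open Permutations

  open import Level using (0ℓ)
  open import Data.Nat using (ℕ; _*_; _!)
  open import Data.Fin.Permutation using (Permutation′; _⟨$⟩ʳ_; _⟨$⟩ˡ_; _∘ₚ_; flip; inverseˡ; inverseʳ)
    renaming (_≈_ to _≈ₚ_)
  open import Data.List using (List; length; map)
  open import Data.List.Properties using (length-map)
  open import Data.List.Relation.Unary.All as All using (All)
  open import Data.Product using (∃-syntax; _×_; _,_)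
  open import Data.Unit using (⊤; tt)
  open import Relation.Binary using (DecSetoid)
  open import Relation.Binary.PropositionalEquality as ≡ using (_≡_; cong)

  -- Composition of permutations, in the order of function composition.
  _∙_ : ∀ {k} → Permutation′ k → Permutation′ k → Permutation′ k
  σ ∙ τ = τ ∘ₚ σ

  module _ {k : ℕ} where

    ∙-congʳ : ∀ σ {τ τ′ : Permutation′ k} → τ ≈ₚ τ′ → σ ∙ τ ≈ₚ σ ∙ τ′
    ∙-congʳ σ τ≈τ′ i = cong (σ ⟨$⟩ʳ_) (τ≈τ′ i)

    ∙-cancelˡ : ∀ σ {τ τ′ : Permutation′ k} → σ ∙ τ ≈ₚ σ ∙ τ′ → τ ≈ₚ τ′
    ∙-cancelˡ σ στ≈στ′ i = ≡.trans (≡.sym (inverseˡ σ)) (≡.trans (cong (σ ⟨$⟩ˡ_) (στ≈στ′ i)) (inverseˡ σ))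

    ∙-inverse : ∀ (σ τ : Permutation′ k) → σ ∙ (flip σ ∙ τ) ≈ₚ τ
    ∙-inverse σ τ i = inverseʳ σ

    -- Orbit–stabiliser theorem for 𝔖ₖ.  F : 𝔖ₖ → X is the orbit map of a point and H
    -- its stabiliser: F σ ≈ F σ₀ exactly when σ ∈ σ₀H.  Then k! = |orbit| · |H|.
    orbit-stabiliser : (X : DecSetoid 0ℓ 0ℓ) → let open DecSetoid X using (_≈_) renaming (Carrier to A) in
                       (F : Permutation′ k → A) (H : Permutation′ k → Set) →
                       (∀ {σ σ′} → σ ≈ₚ σ′ → F σ ≈ F σ′) →
                       (∀ σ₀ σ → F σ ≈ F σ₀ → H (flip σ₀ ∙ σ)) →
                       (∀ σ₀ τ → H τ → F (σ₀ ∙ τ) ≈ F σ₀) →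
                       ∀ {LO LH} → Enumerates _≈_ (λ x → ∃[ σ ] x ≈ F σ) LO → Enumerates _≈ₚ_ H LH →
                       k ! ≡ length LO * length LH
    orbit-stabiliser X F H F-cong coset⇒H H⇒coset {LO} {LH} eO eH = begin
      k !                            ≡⟨ length-allPerms k ⟨
      length (allPerms k)            ≡⟨ double-counting (permSetoid k) setoid E (λ o σ → F σ ≟ o)
                                          (λ σ≈σ′ Fσ≈o → trans (sym (F-cong σ≈σ′)) Fσ≈o)
                                          (λ Fσ≈o Fσ≈o′ → trans (sym Fσ≈o) Fσ≈o′)
                                          (allPerms-enumerates k) (Enumerates.distinct eO)
                                          (λ σ _ → Enumerates.complete eO (F σ) (σ , refl))
                                          (All.map coset (Enumerates.sound eO)) ⟩
      length LO * length LH ∎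
      where
      open DecSetoid X
      open ≡.≡-Reasoning
      E : Permutation′ k → Carrier → Set
      E σ o = F σ ≈ o
      -- The permutations sending the point to o ≈ F σ₀ form the coset σ₀H.
      coset : ∀ {o} → ∃[ σ₀ ] o ≈ F σ₀ → HasSize (permSetoid k) (λ σ → ⊤ × E σ o) (length LH)
      coset {o} (σ₀ , o≈Fσ₀) = map (σ₀ ∙_) LH ,
        enumerates-map (permSetoid k) (permSetoid k) (σ₀ ∙_) (λ {τ} {τ′} → ∙-congʳ σ₀ {τ} {τ′}) (λ {τ} {τ′} → ∙-cancelˡ σ₀ {τ} {τ′})
          (λ τ Hτ → tt , trans (H⇒coset σ₀ τ Hτ) (sym o≈Fσ₀))
          (λ σ (_ , Fσ≈o) → flip σ₀ ∙ σ , coset⇒H σ₀ σ (trans Fσ≈o o≈Fσ₀) , λ i → ≡.sym (∙-inverse σ₀ σ i))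
          eH ,
        length-map (σ₀ ∙_) LH

-- Arithmetic modulo n: cancellation by primes and the ring laws of ℤ/nℤ.
module Modular where

  open import Data.Nat using (ℕ; zero; suc; _+_; _*_; _∸_; _≤_; _<_; _%_; _/_; NonZero)
  open import Data.Nat.Properties
  open import Data.Nat.DivMod using (_mod_; m≡m%n+[m/n]*n; %-distribˡ-+; %-distribˡ-*; m%n%n≡m%n; m<n⇒m%n≡m; n%n≡0)
  open import Data.Nat.Divisibility using (_∣_; divides; >⇒∤)
  open import Data.Nat.Primality using (Prime; euclidsLemma; prime⇒nonZero)
  open import Data.Fin using (Fin; toℕ) renaming (zero to 0F)
  open import Data.Fin.Properties using (toℕ-injective; toℕ-fromℕ<; toℕ<n)
  open import Data.Sum using (inj₁; inj₂)
  open import Data.Product using (_,_)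
  open import Data.Empty using (⊥-elim)
  open import Relation.Binary.PropositionalEquality

  %≡⇒∣∸ : ∀ {n} .{{_ : NonZero n}} a b → b ≤ a → a % n ≡ b % n → n ∣ a ∸ b
  %≡⇒∣∸ {n} a b b≤a a≡b = divides (a / n ∸ b / n) (begin
    a ∸ b                                      ≡⟨ cong₂ _∸_ (m≡m%n+[m/n]*n a n) (m≡m%n+[m/n]*n b n) ⟩
    (a % n + a / n * n) ∸ (b % n + b / n * n)  ≡⟨ cong (λ r → (r + a / n * n) ∸ (b % n + b / n * n)) a≡b ⟩
    (b % n + a / n * n) ∸ (b % n + b / n * n)  ≡⟨ [m+n]∸[m+o]≡n∸o (b % n) _ _ ⟩
    a / n * n ∸ b / n * n                      ≡⟨ *-distribʳ-∸ n (a / n) (b / n) ⟨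
    (a / n ∸ b / n) * n                        ∎)
    where open ≡-Reasoning

  module _ {p : ℕ} (p-prime : Prime p) where
    private instance _ = prime⇒nonZero p-prime

    private
      below-p : ∀ {d} → d < p → p ∣ d → d ≡ 0
      below-p {zero}  _   _   = refl
      below-p {suc d} d<p p∣d = ⊥-elim (>⇒∤ d<p p∣d)

      cancel-≤ : ∀ c a b x → b ≤ a → a < p → x < p → x ≢ 0 →
                 (c + a * x) % p ≡ (c + b * x) % p → a ≤ b
      cancel-≤ c a b x b≤a a<p x<p x≢0 ≡mod with euclidsLemma (a ∸ b) x p-prime p∣[a∸b]x
        where
        p∣[a∸b]x : p ∣ (a ∸ b) * x
        p∣[a∸b]x = subst (p ∣_) (trans ([m+n]∸[m+o]≡n∸o c (a * x) (b * x)) (sym (*-distribʳ-∸ x a b)))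
                     (%≡⇒∣∸ (c + a * x) (c + b * x) (+-monoʳ-≤ c (*-monoˡ-≤ x b≤a)) ≡mod)
      ... | inj₁ p∣a∸b = m∸n≡0⇒m≤n (below-p (≤-<-trans (m∸n≤m a b) a<p) p∣a∸b)
      ... | inj₂ p∣x   = ⊥-elim (x≢0 (below-p x<p p∣x))

    cancel-mod-prime : ∀ c a b x → a < p → b < p → x < p → x ≢ 0 →
                       (c + a * x) % p ≡ (c + b * x) % p → a ≡ b
    cancel-mod-prime c a b x a<p b<p x<p x≢0 ≡mod with ≤-total b a
    ... | inj₁ b≤a = ≤-antisym (cancel-≤ c a b x b≤a a<p x<p x≢0 ≡mod) b≤a
    ... | inj₂ a≤b = ≤-antisym a≤b (cancel-≤ c b a x a≤b b<p x<p x≢0 (sym ≡mod))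

  module ZModLaws (m : ℕ) where
    n : ℕ
    n = suc m

    open ZMod n public

    negₙ : Fin n → Fin n
    negₙ x = (n ∸ toℕ x) mod n

    toℕ-mod : ∀ a → toℕ (a mod n) ≡ a % n
    toℕ-mod a = toℕ-fromℕ< _

    mod-cong : ∀ a b → a % n ≡ b % n → a mod n ≡ b mod n
    mod-cong a b a≡b = toℕ-injective (trans (toℕ-mod a) (trans a≡b (sym (toℕ-mod b))))

    mod-toℕ : ∀ x → toℕ x mod n ≡ x
    mod-toℕ x = toℕ-injective (trans (toℕ-mod (toℕ x)) (m<n⇒m%n≡m (toℕ<n x)))

    mod-+ˡ : ∀ a b → (toℕ (a mod n) + b) mod n ≡ (a + b) mod n
    mod-+ˡ a b = mod-cong (toℕ (a mod n) + b) (a + b) (begin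
      (toℕ (a mod n) + b) % n     ≡⟨ cong (λ r → (r + b) % n) (toℕ-mod a) ⟩
      (a % n + b) % n             ≡⟨ %-distribˡ-+ (a % n) b n ⟩
      (a % n % n + b % n) % n     ≡⟨ cong (λ r → (r + b % n) % n) (m%n%n≡m%n a n) ⟩
      (a % n + b % n) % n         ≡⟨ %-distribˡ-+ a b n ⟨
      (a + b) % n                 ∎)
      where open ≡-Reasoning

    mod-+ʳ : ∀ a b → (a + toℕ (b mod n)) mod n ≡ (a + b) mod n
    mod-+ʳ a b = begin
      (a + toℕ (b mod n)) mod n   ≡⟨ cong (_mod n) (+-comm a _) ⟩
      (toℕ (b mod n) + a) mod n   ≡⟨ mod-+ˡ b a ⟩
      (b + a) mod n               ≡⟨ cong (_mod n) (+-comm b a) ⟩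
      (a + b) mod n               ∎
      where open ≡-Reasoning

    mod-*ˡ : ∀ a b → (toℕ (a mod n) * b) mod n ≡ (a * b) mod n
    mod-*ˡ a b = mod-cong (toℕ (a mod n) * b) (a * b) (begin
      (toℕ (a mod n) * b) % n     ≡⟨ cong (λ r → (r * b) % n) (toℕ-mod a) ⟩
      (a % n * b) % n             ≡⟨ %-distribˡ-* (a % n) b n ⟩
      (a % n % n * (b % n)) % n   ≡⟨ cong (λ r → (r * (b % n)) % n) (m%n%n≡m%n a n) ⟩
      (a % n * (b % n)) % n       ≡⟨ %-distribˡ-* a b n ⟨
      (a * b) % n                 ∎)
      where open ≡-Reasoning

    mod-*ʳ : ∀ a b → (a * toℕ (b mod n)) mod n ≡ (a * b) mod n
    mod-*ʳ a b = begin
      (a * toℕ (b mod n)) mod n   ≡⟨ cong (_mod n) (*-comm a _) ⟩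
      (toℕ (b mod n) * a) mod n   ≡⟨ mod-*ˡ b a ⟩
      (b * a) mod n               ≡⟨ cong (_mod n) (*-comm b a) ⟩
      (a * b) mod n               ∎
      where open ≡-Reasoning

    +ₙ-comm : ∀ x y → x +ₙ y ≡ y +ₙ x
    +ₙ-comm x y = cong (_mod n) (+-comm (toℕ x) (toℕ y))

    +ₙ-assoc : ∀ x y z → (x +ₙ y) +ₙ z ≡ x +ₙ (y +ₙ z)
    +ₙ-assoc x y z = begin
      (toℕ (x +ₙ y) + toℕ z) mod n        ≡⟨ mod-+ˡ (toℕ x + toℕ y) (toℕ z) ⟩
      (toℕ x + toℕ y + toℕ z) mod n       ≡⟨ cong (_mod n) (+-assoc (toℕ x) (toℕ y) (toℕ z)) ⟩
      (toℕ x + (toℕ y + toℕ z)) mod n     ≡⟨ mod-+ʳ (toℕ x) (toℕ y + toℕ z) ⟨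
      (toℕ x + toℕ (y +ₙ z)) mod n        ∎
      where open ≡-Reasoning

    +ₙ-identityʳ : ∀ x → x +ₙ 0F ≡ x
    +ₙ-identityʳ x = trans (cong (_mod n) (+-identityʳ (toℕ x))) (mod-toℕ x)

    +ₙ-identityˡ : ∀ x → 0F +ₙ x ≡ x
    +ₙ-identityˡ x = mod-toℕ x

    +ₙ-inverseʳ : ∀ x → x +ₙ negₙ x ≡ 0F
    +ₙ-inverseʳ x = begin
      (toℕ x + toℕ ((n ∸ toℕ x) mod n)) mod n  ≡⟨ mod-+ʳ (toℕ x) (n ∸ toℕ x) ⟩
      (toℕ x + (n ∸ toℕ x)) mod n              ≡⟨ cong (_mod n) (m+[n∸m]≡n (<⇒≤ (toℕ<n x))) ⟩
      n mod n                                  ≡⟨ toℕ-injective (trans (toℕ-mod n) (n%n≡0 n)) ⟩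
      0F                                       ∎
      where open ≡-Reasoning

    +ₙ-inverseˡ : ∀ x → negₙ x +ₙ x ≡ 0F
    +ₙ-inverseˡ x = trans (+ₙ-comm (negₙ x) x) (+ₙ-inverseʳ x)

    inverse-unique : ∀ x a → x +ₙ a ≡ 0F → a ≡ negₙ x
    inverse-unique x a x+a≡0 = begin
      a                     ≡⟨ +ₙ-identityˡ a ⟨
      0F +ₙ a               ≡⟨ cong (_+ₙ a) (+ₙ-inverseˡ x) ⟨
      (negₙ x +ₙ x) +ₙ a    ≡⟨ +ₙ-assoc (negₙ x) x a ⟩
      negₙ x +ₙ (x +ₙ a)    ≡⟨ cong (negₙ x +ₙ_) x+a≡0 ⟩
      negₙ x +ₙ 0F          ≡⟨ +ₙ-identityʳ (negₙ x) ⟩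
      negₙ x                ∎
      where open ≡-Reasoning

    *ₙ-comm : ∀ x y → x *ₙ y ≡ y *ₙ x
    *ₙ-comm x y = cong (_mod n) (*-comm (toℕ x) (toℕ y))

    *ₙ-assoc : ∀ x y z → (x *ₙ y) *ₙ z ≡ x *ₙ (y *ₙ z)
    *ₙ-assoc x y z = begin
      (toℕ (x *ₙ y) * toℕ z) mod n        ≡⟨ mod-*ˡ (toℕ x * toℕ y) (toℕ z) ⟩
      (toℕ x * toℕ y * toℕ z) mod n       ≡⟨ cong (_mod n) (*-assoc (toℕ x) (toℕ y) (toℕ z)) ⟩
      (toℕ x * (toℕ y * toℕ z)) mod n     ≡⟨ mod-*ʳ (toℕ x) (toℕ y * toℕ z) ⟨
      (toℕ x * toℕ (y *ₙ z)) mod n        ∎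
      where open ≡-Reasoning

    *ₙ-identityˡ : ∀ x → oneₙ *ₙ x ≡ x
    *ₙ-identityˡ x = trans (mod-*ˡ 1 (toℕ x)) (trans (cong (_mod n) (*-identityˡ (toℕ x))) (mod-toℕ x))

    *ₙ-zeroʳ : ∀ x → x *ₙ 0F ≡ 0F
    *ₙ-zeroʳ x = cong (_mod n) (*-zeroʳ (toℕ x))

    *ₙ-distribˡ-+ₙ : ∀ k x y → k *ₙ (x +ₙ y) ≡ (k *ₙ x) +ₙ (k *ₙ y)
    *ₙ-distribˡ-+ₙ k x y = begin
      (toℕ k * toℕ (x +ₙ y)) mod n                    ≡⟨ mod-*ʳ (toℕ k) (toℕ x + toℕ y) ⟩
      (toℕ k * (toℕ x + toℕ y)) mod n                 ≡⟨ cong (_mod n) (*-distribˡ-+ (toℕ k) (toℕ x) (toℕ y)) ⟩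
      (toℕ k * toℕ x + toℕ k * toℕ y) mod n           ≡⟨ mod-+ʳ (toℕ k * toℕ x) (toℕ k * toℕ y) ⟨
      (toℕ k * toℕ x + toℕ (k *ₙ y)) mod n            ≡⟨ mod-+ˡ (toℕ k * toℕ x) (toℕ (k *ₙ y)) ⟨
      (toℕ (k *ₙ x) + toℕ (k *ₙ y)) mod n             ∎
      where open ≡-Reasoning

    *ₙ-cancelʳ : Prime n → ∀ {k k′ x} → x ≢ 0F → k *ₙ x ≡ k′ *ₙ x → k ≡ k′
    *ₙ-cancelʳ n-prime {k} {k′} {x} x≢0 kx≡k′x = toℕ-injective
      (cancel-mod-prime n-prime 0 (toℕ k) (toℕ k′) (toℕ x) (toℕ<n k) (toℕ<n k′) (toℕ<n x)
        (λ x≡0 → x≢0 (toℕ-injective x≡0))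
        (trans (sym (toℕ-mod (toℕ k * toℕ x))) (trans (cong toℕ kx≡k′x) (toℕ-mod (toℕ k′ * toℕ x)))))

    IsUnit-*ₙ : ∀ {k k₂} → IsUnit k → IsUnit k₂ → IsUnit (k₂ *ₙ k)
    IsUnit-*ₙ {k} {k₂} (k′ , kk′≡1) (k₂′ , k₂k₂′≡1) = k′ *ₙ k₂′ , (begin
      (k₂ *ₙ k) *ₙ (k′ *ₙ k₂′)   ≡⟨ *ₙ-assoc k₂ k _ ⟩
      k₂ *ₙ (k *ₙ (k′ *ₙ k₂′))   ≡⟨ cong (k₂ *ₙ_) (sym (*ₙ-assoc k k′ k₂′)) ⟩
      k₂ *ₙ ((k *ₙ k′) *ₙ k₂′)   ≡⟨ cong (λ c → k₂ *ₙ (c *ₙ k₂′)) kk′≡1 ⟩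
      k₂ *ₙ (oneₙ *ₙ k₂′)        ≡⟨ cong (k₂ *ₙ_) (*ₙ-identityˡ k₂′) ⟩
      k₂ *ₙ k₂′                  ≡⟨ k₂k₂′≡1 ⟩
      oneₙ                       ∎)
      where open ≡-Reasoning

-- The three actions on tuples over ℤ/nℤ (n = 1 + m) and their basic laws.
module TupleActions (m : ℕ) where
  open Counting using (enumerates-deduplicate)
  open Permutations using (permSetoid; allPerms; allPerms-enumerates)
  open Modular

  open import Level using (0ℓ)
  open import Data.Nat using (ℕ)
  open import Data.Fin using (Fin) renaming (zero to 0F)
  open import Data.Fin.Properties using (_≟_; all?)
  open import Data.Fin.Permutation using (Permutation′; _⟨$⟩ʳ_; _⟨$⟩ˡ_; flip; inverseˡ; inverseʳ)
  open import Data.Product using (∃-syntax; _,_)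
  open import Data.Unit using (tt)
  open import Data.List using (List; map; deduplicate)
  import Data.List.Relation.Unary.All as All
  open import Data.List.Relation.Unary.Any using (Any)
  import Data.List.Relation.Unary.All.Properties as All
  import Data.List.Membership.Setoid.Properties as ∈
  open import Relation.Binary using (DecSetoid)
  open import Relation.Binary.PropositionalEquality
  import Relation.Binary.Reasoning.Setoid as SetoidReasoning

  open ZModLaws m public

  tupleSetoid : DecSetoid 0ℓ 0ℓ
  tupleSetoid = record
    { Carrier          = Tuple
    ; _≈_              = _≗_
    ; isDecEquivalence = record
      { isEquivalence = record
        { refl  = λ _ → refl
        ; sym   = λ t≗u i → sym (t≗u i)
        ; trans = λ t≗u u≗v i → trans (t≗u i) (u≗v i) }
      ; _≟_ = λ t u → all? (λ i → t i ≟ u i) } }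

  open DecSetoid tupleSetoid public using () renaming (refl to ≗-refl; sym to ≗-sym; trans to ≗-trans)

  module ≗-Reasoning = SetoidReasoning (DecSetoid.setoid tupleSetoid)

  act-resp : ∀ σ {t u} → t ≗ u → act σ t ≗ act σ u
  act-resp σ t≗u i = t≗u (σ ⟨$⟩ˡ i)

  act-cong : ∀ {σ σ′} t → σ ≈ₚ σ′ → act σ t ≗ act σ′ t
  act-cong {σ} {σ′} t σ≈σ′ i = cong t (begin
    σ ⟨$⟩ˡ i                       ≡⟨ cong (σ ⟨$⟩ˡ_) (inverseʳ σ′) ⟨
    σ ⟨$⟩ˡ (σ′ ⟨$⟩ʳ (σ′ ⟨$⟩ˡ i))    ≡⟨ cong (σ ⟨$⟩ˡ_) (σ≈σ′ (σ′ ⟨$⟩ˡ i)) ⟨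
    σ ⟨$⟩ˡ (σ ⟨$⟩ʳ (σ′ ⟨$⟩ˡ i))     ≡⟨ inverseˡ σ ⟩
    σ′ ⟨$⟩ˡ i                      ∎)
    where open ≡-Reasoning

  act-inverse : ∀ σ t → act (flip σ) (act σ t) ≗ t
  act-inverse σ t i = cong t (inverseˡ σ)

  shift-resp : ∀ a {t u} → t ≗ u → shift a t ≗ shift a u
  shift-resp a t≗u i = cong (_+ₙ a) (t≗u i)

  shift-shift : ∀ a b t → shift a (shift b t) ≗ shift (b +ₙ a) t
  shift-shift a b t i = +ₙ-assoc (t i) b a

  shift-zero : ∀ t → shift 0F t ≗ t
  shift-zero t i = +ₙ-identityʳ (t i)

  shift-neg : ∀ a t → shift (negₙ a) (shift a t) ≗ t
  shift-neg a t i = begin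
    (t i +ₙ a) +ₙ negₙ a  ≡⟨ +ₙ-assoc (t i) a (negₙ a) ⟩
    t i +ₙ (a +ₙ negₙ a)  ≡⟨ cong (t i +ₙ_) (+ₙ-inverseʳ a) ⟩
    t i +ₙ 0F             ≡⟨ +ₙ-identityʳ (t i) ⟩
    t i                   ∎
    where open ≡-Reasoning

  shift-back : ∀ a {t u} → t ≗ shift a u → u ≗ shift (negₙ a) t
  shift-back a {t} {u} t≗u+a = ≗-sym (≗-trans (shift-resp (negₙ a) t≗u+a) (shift-neg a u))

  scale-resp : ∀ k {t u} → t ≗ u → scale k t ≗ scale k u
  scale-resp k t≗u i = cong (k *ₙ_) (t≗u i)

  scale-scale : ∀ k k′ t → scale k (scale k′ t) ≗ scale (k *ₙ k′) t
  scale-scale k k′ t i = sym (*ₙ-assoc k k′ (t i))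

  scale-one : ∀ t → scale oneₙ t ≗ t
  scale-one t i = *ₙ-identityˡ (t i)

  scale-shift : ∀ k a t → scale k (shift a t) ≗ shift (k *ₙ a) (scale k t)
  scale-shift k a t i = *ₙ-distribˡ-+ₙ k (t i) a

  -- The canonical representative of the ℤ/nℤ-orbit [u]: the shift with first coordinate 0.
  norm : Tuple → Tuple
  norm u = shift (negₙ (u 0F)) u

  norm-resp : ∀ {u v} → u ≗ v → norm u ≗ norm v
  norm-resp {u} {v} u≗v = ≗-trans (shift-resp (negₙ (u 0F)) u≗v) (λ i → cong (λ a → v i +ₙ negₙ a) (u≗v 0F))

  norm-char : ∀ u a → u 0F +ₙ a ≡ 0F → shift a u ≗ norm u
  norm-char u a u₀+a≡0 i = cong (u i +ₙ_) (inverse-unique (u 0F) a u₀+a≡0)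

  norm-shift : ∀ j u → norm (shift j u) ≗ norm u
  norm-shift j u = ≗-trans (shift-shift (negₙ (u 0F +ₙ j)) j u) (norm-char u _
    (trans (sym (+ₙ-assoc (u 0F) j _)) (+ₙ-inverseʳ (u 0F +ₙ j))))

  unnorm : ∀ u → u ≗ shift (u 0F) (norm u)
  unnorm u = ≗-trans (≗-sym (shift-zero u)) (≗-trans (λ i → cong (u i +ₙ_) (sym (+ₙ-inverseˡ (u 0F))))
               (≗-sym (shift-shift (u 0F) (negₙ (u 0F)) u)))

  norm-SameClass : ∀ u v → norm u ≗ norm v → SameClass u v
  norm-SameClass u v nu≗nv = negₙ (v 0F) +ₙ u 0F ,
    ≗-trans (unnorm u) (≗-trans (shift-resp (u 0F) nu≗nv) (shift-shift (u 0F) (negₙ (v 0F)) v))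

  scale-norm : ∀ k u → scale k (norm u) ≗ norm (scale k u)
  scale-norm k u = ≗-trans (scale-shift k _ u) (norm-char (scale k u) _ (begin
    (k *ₙ u 0F) +ₙ (k *ₙ negₙ (u 0F)) ≡⟨ *ₙ-distribˡ-+ₙ k (u 0F) _ ⟨
    k *ₙ (u 0F +ₙ negₙ (u 0F))      ≡⟨ cong (k *ₙ_) (+ₙ-inverseʳ (u 0F)) ⟩
    k *ₙ 0F                         ≡⟨ *ₙ-zeroʳ k ⟩
    0F                              ∎))
    where open ≡-Reasoning

  scale-back : ∀ k k′ {t u} → k′ *ₙ k ≡ oneₙ → u ≗ scale k t → t ≗ scale k′ u
  scale-back k k′ {t} {u} k′k≡1 u≗kt = ≗-sym (begin
    scale k′ u             ≈⟨ scale-resp k′ u≗kt ⟩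
    scale k′ (scale k t)   ≈⟨ scale-scale k′ k t ⟩
    scale (k′ *ₙ k) t      ≈⟨ (λ i → cong (_*ₙ t i) k′k≡1) ⟩
    scale oneₙ t           ≈⟨ scale-one t ⟩
    t                      ∎)
    where open ≗-Reasoning

  module _ (s : Tuple) where

    -- The class [σs], represented by the normalisation of σs.
    classOf : Permutation′ n → Tuple
    classOf σ = norm (act σ s)

    classOf-cong : ∀ {σ σ′} → σ ≈ₚ σ′ → classOf σ ≗ classOf σ′
    classOf-cong {σ} {σ′} σ≈σ′ = norm-resp (act-cong {σ} {σ′} s σ≈σ′)

    NormPerm : Tuple → Set
    NormPerm t = ∃[ σ ] t ≗ classOf σ

    classes : List Tuple
    classes = deduplicate (DecSetoid._≟_ tupleSetoid) (map classOf (allPerms n))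

    classes-enumerates : Enumerates _≗_ NormPerm classes
    classes-enumerates = enumerates-deduplicate tupleSetoid (map classOf (allPerms n))
      (All.map⁺ (All.universal (λ σ → σ , ≗-refl) (allPerms n))) listed
      where
      listed : ∀ t → NormPerm t → Any (t ≗_) (map classOf (allPerms n))
      listed t (σ , t≗[σs]) = ∈.∈-resp-≈ (DecSetoid.setoid tupleSetoid) (≗-sym {t} {classOf σ} t≗[σs])
         (∈.∈-map⁺ (permSetoid n) (DecSetoid.setoid tupleSetoid) (λ {σ} {σ′} → classOf-cong {σ} {σ′}) {σ} {allPerms n}
           (Enumerates.complete (allPerms-enumerates n) σ tt))

-- Comparison of the stabilisers S′ₛ ⊆ S̄ₛ for n = 1 + m prime: equality holds unless
-- s is, up to a shift, a permutation of (0,1,…,n−1).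
module Stabilisers (m : ℕ) (n-prime : Prime (suc m)) where
  open import Data.Nat using (ℕ; zero; suc; _+_; _*_; _%_; _!)
  open import Data.List using (length)
  open import Data.Nat.DivMod using (_mod_)
  open import Data.Nat.Properties using (+-identityʳ; +-assoc; +-comm)
  open import Data.Fin using (Fin; toℕ) renaming (zero to 0F)
  open import Data.Fin.Properties using (_≟_; toℕ-injective; toℕ<n)
  open import Data.Fin.Permutation using (Permutation′; _⟨$⟩ˡ_; permutation; flip)
  open import Data.Product using (∃-syntax; _,_; proj₁; proj₂)
  open import Data.Empty using (⊥-elim)
  open import Relation.Nullary using (¬_; yes; no)
  open import Relation.Binary.PropositionalEquality
  open Permutations using (injective⇒surjective)
  open OrbitStabiliser using (_∙_; orbit-stabiliser)
  open Modular using (cancel-mod-prime)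
  open TupleActions m

  injective⇒ClassOfId : ∀ s → (∀ {x y} → s x ≡ s y → x ≡ y) → ClassOfId s
  injective⇒ClassOfId s s-inj = σ , 0F , λ i → sym (+ₙ-identityʳ (s i))
    where
    s⁻¹ : Fin n → Fin n
    s⁻¹ y = proj₁ (injective⇒surjective s s-inj y)
    σ : Permutation′ n
    σ = permutation s⁻¹ s (λ x → s-inj (proj₂ (injective⇒surjective s s-inj (s x))))
                          (λ y → proj₂ (injective⇒surjective s s-inj y))

  module _ (s : Tuple) (τ : Permutation′ n) (j : Fin n) (τs≗s+j : act τ s ≗ shift j s) where

    orbit : ℕ → Fin n
    orbit zero    = 0F
    orbit (suc a) = τ ⟨$⟩ˡ orbit a

    progression : ∀ a → s (orbit a) ≡ (toℕ (s 0F) + a * toℕ j) mod n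
    progression zero    = sym (trans (cong (_mod n) (+-identityʳ (toℕ (s 0F)))) (mod-toℕ (s 0F)))
    progression (suc a) = begin
      s (τ ⟨$⟩ˡ orbit a)                               ≡⟨ τs≗s+j (orbit a) ⟩
      s (orbit a) +ₙ j                                 ≡⟨ cong (_+ₙ j) (progression a) ⟩
      (toℕ ((toℕ (s 0F) + a * toℕ j) mod n) + toℕ j) mod n ≡⟨ mod-+ˡ (toℕ (s 0F) + a * toℕ j) (toℕ j) ⟩
      (toℕ (s 0F) + a * toℕ j + toℕ j) mod n           ≡⟨ cong (_mod n) (trans (+-assoc (toℕ (s 0F)) _ _) (cong (toℕ (s 0F) +_) (+-comm (a * toℕ j) (toℕ j)))) ⟩
      (toℕ (s 0F) + suc a * toℕ j) mod n               ∎
      where open ≡-Reasoning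

    module _ (j≢0 : j ≢ 0F) where

      -- For j ≠ 0 the progression has n distinct terms …
      orbit′ : Fin n → Fin n
      orbit′ a = orbit (toℕ a)

      s∘orbit′-injective : ∀ {a b} → s (orbit′ a) ≡ s (orbit′ b) → a ≡ b
      s∘orbit′-injective {a} {b} e = toℕ-injective (cancel-mod-prime n-prime (toℕ (s 0F)) (toℕ a) (toℕ b) (toℕ j)
        (toℕ<n a) (toℕ<n b) (toℕ<n j) (λ j≡0 → j≢0 (toℕ-injective j≡0)) (begin
        (toℕ (s 0F) + toℕ a * toℕ j) % n                ≡⟨ toℕ-mod (toℕ (s 0F) + toℕ a * toℕ j) ⟨
        toℕ ((toℕ (s 0F) + toℕ a * toℕ j) mod n)        ≡⟨ cong toℕ (trans (sym (progression (toℕ a))) (trans e (progression (toℕ b)))) ⟩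
        toℕ ((toℕ (s 0F) + toℕ b * toℕ j) mod n)        ≡⟨ toℕ-mod (toℕ (s 0F) + toℕ b * toℕ j) ⟩
        (toℕ (s 0F) + toℕ b * toℕ j) % n                ∎))
        where open ≡-Reasoning

      orbit′-surjective : ∀ x → ∃[ a ] orbit′ a ≡ x
      orbit′-surjective = injective⇒surjective orbit′ (λ {a} {b} e → s∘orbit′-injective {a} {b} (cong s e))

      -- … so the orbit meets every point and s takes n distinct values.
      shift-stable⇒injective : ∀ {x y} → s x ≡ s y → x ≡ y
      shift-stable⇒injective {x} {y} sx≡sy with orbit′-surjective x | orbit′-surjective y
      ... | a , refl | b , refl = cong orbit′ (s∘orbit′-injective {a} {b} sx≡sy)

  module _ (s : Tuple) where

    S′-coset⇒ : ∀ σ₀ σ → act σ s ≗ act σ₀ s → InS′ s (flip σ₀ ∙ σ)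
    S′-coset⇒ σ₀ σ σs≗σ₀s = ≗-trans (act-resp (flip σ₀) σs≗σ₀s) (act-inverse σ₀ s)

    S′-⇒coset : ∀ σ₀ τ → InS′ s τ → act (σ₀ ∙ τ) s ≗ act σ₀ s
    S′-⇒coset σ₀ τ τs≗s = act-resp σ₀ τs≗s

    S̄-coset⇒ : ∀ σ₀ σ → norm (act σ s) ≗ norm (act σ₀ s) → InSbar s (flip σ₀ ∙ σ)
    S̄-coset⇒ σ₀ σ [σs]≗[σ₀s] with norm-SameClass (act σ s) (act σ₀ s) [σs]≗[σ₀s]
    ... | j , σs≗σ₀s+j = j , ≗-trans (act-resp (flip σ₀) σs≗σ₀s+j) (shift-resp j (act-inverse σ₀ s))

    S̄-⇒coset : ∀ σ₀ τ → InSbar s τ → norm (act (σ₀ ∙ τ) s) ≗ norm (act σ₀ s)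
    S̄-⇒coset σ₀ τ (j , τs≗s+j) = ≗-trans (norm-resp (act-resp σ₀ τs≗s+j)) (norm-shift j (act σ₀ s))

    n!≡γ·|S′| : ∀ {Lγ L′} → Enumerates _≗_ (IsPermOf s) Lγ → Enumerates _≈ₚ_ (InS′ s) L′ →
                n ! ≡ length Lγ * length L′
    n!≡γ·|S′| = orbit-stabiliser tupleSetoid (λ σ → act σ s) (InS′ s) (λ {σ} {σ′} → act-cong {σ} {σ′} s)
                  S′-coset⇒ S′-⇒coset

    n!≡#classes·|S̄| : ∀ {L̄} → Enumerates _≈ₚ_ (InSbar s) L̄ → n ! ≡ length (classes s) * length L̄
    n!≡#classes·|S̄| = orbit-stabiliser tupleSetoid (classOf s) (InSbar s) (λ {σ} {σ′} → classOf-cong s {σ} {σ′})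
                        S̄-coset⇒ S̄-⇒coset (classes-enumerates s)

  S′⊆S̄ : ∀ s τ → InS′ s τ → InSbar s τ
  S′⊆S̄ s τ τs≗s = 0F , ≗-trans τs≗s (≗-sym (shift-zero s))

  -- A permutation fixing [s] moves s by some shift j; if j ≠ 0, s is injective.
  S̄⊆S′ : ∀ s → ¬ ClassOfId s → ∀ τ → InSbar s τ → InS′ s τ
  S̄⊆S′ s not-id τ (j , τs≗s+j) with j ≟ 0F
  ... | yes refl = ≗-trans τs≗s+j (shift-zero s)
  ... | no  j≢0  = ⊥-elim (not-id (injective⇒ClassOfId s (shift-stable⇒injective s τ j τs≗s+j j≢0)))

-- The action of K(s) on the classes [σs], for n prime and s non-constant.
module KAction (m : ℕ) (n-prime : Prime (suc m)) (s : ZMod.Tuple (suc m)) (nonconstant : ¬ ZMod.Constant (suc m) s)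
               {LK : List (Fin (suc m))} (eK : Enumerates _≡_ (ZMod.InK (suc m) s) LK) where
  open import Data.Nat using (ℕ; suc)
  open import Data.Nat.Divisibility using (_∣_; divides)
  open import Data.Fin using (Fin) renaming (zero to 0F)
  open import Data.Fin.Properties using (_≟_; ¬∀⟶∃¬)
  open import Data.Fin.Permutation using (_⟨$⟩ʳ_; flip; inverseˡ) renaming (id to idₚ)
  open import Data.List using (List; length; map; deduplicate)
  open import Data.List.Properties using (length-map)
  open import Data.List.Relation.Unary.All as All using (All)
  open import Data.List.Relation.Unary.Any as Any using (Any)
  open import Data.Product using (∃-syntax; _×_; _,_; proj₁)
  open import Relation.Nullary using (¬_)
  open import Relation.Binary using (Setoid; DecSetoid)
  open import Relation.Binary.PropositionalEquality as ≡ using (_≡_; _≢_; _≗_; refl; cong)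
  open import Level using (0ℓ)
  open Counting
  open OrbitStabiliser using (_∙_)
  open TupleActions m

  InK-one : InK s oneₙ
  InK-one = (oneₙ , *ₙ-identityˡ oneₙ) , idₚ , 0F , λ i → ≡.trans (scale-one s i) (≡.sym (shift-zero s i))

  InK-mul : ∀ k k₂ → InK s k → InK s k₂ → InK s (k₂ *ₙ k)
  InK-mul k k₂ (k-unit , σ , j , ks≗σs+j) (k₂-unit , σ₂ , j₂ , k₂s≗σ₂s+j₂) =
    IsUnit-*ₙ {k} {k₂} k-unit k₂-unit , σ ∙ σ₂ , j₂ +ₙ (k₂ *ₙ j) , (begin
      scale (k₂ *ₙ k) s                              ≈⟨ scale-scale k₂ k s ⟨
      scale k₂ (scale k s)                           ≈⟨ scale-resp k₂ ks≗σs+j ⟩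
      scale k₂ (shift j (act σ s))                   ≈⟨ scale-shift k₂ j (act σ s) ⟩
      shift (k₂ *ₙ j) (act σ (scale k₂ s))           ≈⟨ shift-resp (k₂ *ₙ j) (act-resp σ k₂s≗σ₂s+j₂) ⟩
      shift (k₂ *ₙ j) (shift j₂ (act (σ ∙ σ₂) s))    ≈⟨ shift-shift (k₂ *ₙ j) j₂ (act (σ ∙ σ₂) s) ⟩
      shift (j₂ +ₙ (k₂ *ₙ j)) (act (σ ∙ σ₂) s)       ∎)
    where open ≗-Reasoning

  InK-inverse : ∀ k k′ → k *ₙ k′ ≡ oneₙ → InK s k → InK s k′
  InK-inverse k k′ kk′≡1 (_ , σ , j , ks≗σs+j) =
    (k , k′k≡1) , flip σ , negₙ (k′ *ₙ j) , (begin
      scale k′ s                                        ≈⟨ act-inverse σ (scale k′ s) ⟨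
      act (flip σ) (act σ (scale k′ s))                 ≈⟨ act-resp (flip σ) (shift-back (k′ *ₙ j) {s} {act σ (scale k′ s)} s≗k′[σs+j]) ⟩
      shift (negₙ (k′ *ₙ j)) (act (flip σ) s)           ∎)
    where
    open ≗-Reasoning
    k′k≡1 : k′ *ₙ k ≡ oneₙ
    k′k≡1 = ≡.trans (*ₙ-comm k′ k) kk′≡1
    s≗k′[σs+j] : s ≗ shift (k′ *ₙ j) (act σ (scale k′ s))
    s≗k′[σs+j] = begin
      s                                     ≈⟨ scale-back k k′ k′k≡1 (≗-refl {scale k s}) ⟩
      scale k′ (scale k s)                  ≈⟨ scale-resp k′ ks≗σs+j ⟩
      scale k′ (shift j (act σ s))          ≈⟨ scale-shift k′ j (act σ s) ⟩
      shift (k′ *ₙ j) (act σ (scale k′ s))  ∎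

  -- t ∼ u : u lies in the K(s)-orbit of t (decidable thanks to the enumeration of K(s)).
  _∼_ : Tuple → Tuple → Set
  t ∼ u = Any (λ k → u ≗ scale k t) LK

  ∼-intro : ∀ k {t u} → InK s k → u ≗ scale k t → t ∼ u
  ∼-intro k {t} ik u≗kt = Any.map (λ {k₁} k≡k₁ → ≗-trans u≗kt (λ i → cong (_*ₙ t i) k≡k₁)) (Enumerates.complete eK k ik)

  ∼-elim : ∀ {t u} → t ∼ u → ∃[ k ] InK s k × u ≗ scale k t
  ∼-elim t∼u = Any.lookup t∼u , All.lookupAny (Enumerates.sound eK) t∼u

  orbitSetoid : DecSetoid 0ℓ 0ℓ
  orbitSetoid = record
    { Carrier          = Tuple
    ; _≈_              = _∼_
    ; isDecEquivalence = record
      { isEquivalence = record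
        { refl  = λ {t} → ∼-intro oneₙ InK-one (≗-sym (scale-one t))
        ; sym   = λ t∼u → let (k , ik , u≗kt) = ∼-elim t∼u ; (k′ , kk′≡1) = proj₁ ik in
                    ∼-intro k′ (InK-inverse k k′ kk′≡1 ik) (scale-back k k′ (≡.trans (*ₙ-comm k′ k) kk′≡1) u≗kt)
        ; trans = λ {t} t∼u u∼v → let (k , ik , u≗kt) = ∼-elim t∼u ; (k₂ , ik₂ , v≗k₂u) = ∼-elim u∼v in
                    ∼-intro (k₂ *ₙ k) (InK-mul k k₂ ik ik₂) (≗-trans v≗k₂u (≗-trans (scale-resp k₂ u≗kt) (scale-scale k₂ k t))) }
      ; _≟_ = λ t u → Any.any? (λ k → DecSetoid._≟_ tupleSetoid u (scale k t)) LK } }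

  NormPerm-scale : ∀ k {r} → InK s k → NormPerm s r → NormPerm s (scale k r)
  NormPerm-scale k {r} (_ , τ , j , ks≗τs+j) (σ , r≗σs) = σ ∙ τ , (begin
    scale k r                                 ≈⟨ scale-resp k r≗σs ⟩
    scale k (norm (act σ s))                  ≈⟨ scale-norm k (act σ s) ⟩
    norm (act σ (scale k s))                  ≈⟨ norm-resp (act-resp σ ks≗τs+j) ⟩
    norm (shift j (act (σ ∙ τ) s))            ≈⟨ norm-shift j (act (σ ∙ τ) s) ⟩
    norm (act (σ ∙ τ) s)                      ∎)
    where open ≗-Reasoning

  NormPerm-nonzero : ∀ {r} → NormPerm s r → ∃[ i ] r i ≢ 0F
  NormPerm-nonzero {r} (σ , r≗σs) = ¬∀⟶∃¬ n (λ i → r i ≡ 0F) (λ i → r i ≟ 0F) all-zero⇒constant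
    where
    all-zero⇒constant : ¬ (∀ i → r i ≡ 0F)
    all-zero⇒constant r≡0 = nonconstant (act σ s 0F , λ i → begin
      s i                                     ≡⟨ cong s (inverseˡ σ) ⟨
      act σ s (σ ⟨$⟩ʳ i)                      ≡⟨ unnorm (act σ s) (σ ⟨$⟩ʳ i) ⟩
      norm (act σ s) (σ ⟨$⟩ʳ i) +ₙ act σ s 0F  ≡⟨ cong (_+ₙ act σ s 0F) (≡.trans (≡.sym (r≗σs (σ ⟨$⟩ʳ i))) (r≡0 (σ ⟨$⟩ʳ i))) ⟩
      0F +ₙ act σ s 0F                        ≡⟨ +ₙ-identityˡ (act σ s 0F) ⟩
      act σ s 0F                              ∎)
      where open ≡.≡-Reasoning

  scale-free : ∀ {r k k′} → NormPerm s r → scale k r ≗ scale k′ r → k ≡ k′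
  scale-free r-cls kr≗k′r with NormPerm-nonzero r-cls
  ... | i , rᵢ≢0 = *ₙ-cancelʳ n-prime rᵢ≢0 (kr≗k′r i)

  ≗⇒∼ : ∀ {t u} → t ≗ u → t ∼ u
  ≗⇒∼ {t} t≗u = ∼-intro oneₙ InK-one (≗-trans (≗-sym t≗u) (≗-sym (scale-one t)))

  -- Each class is counted over exactly one K(s)-orbit, and each orbit has |K(s)|
  -- elements, so |K(s)| divides the number of classes [σs].
  K-divides : ∀ {Lc} → Enumerates _≗_ (NormPerm s) Lc → length LK ∣ length Lc
  K-divides {Lc} e-Lc = divides (length reps)
    (double-counting tuples orbits (λ x r → r ∼ x) (λ r x → DecSetoid._≟_ orbitSetoid r x)
      (λ x≗y r∼x → Any.map (λ x≗kr → ≗-trans (≗-sym x≗y) x≗kr) r∼x)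
      (λ r∼x r′∼x → Setoid.trans orbits r∼x (Setoid.sym orbits r′∼x))
      e-Lc (Enumerates.distinct e-reps)
      (λ x x-cls → Any.map (Setoid.sym orbits) (Enumerates.complete e-reps x x-cls))
      (All.map orbit-size (Enumerates.sound e-reps)))
    where
    tuples = DecSetoid.setoid tupleSetoid
    orbits = DecSetoid.setoid orbitSetoid
    reps : List Tuple
    reps = deduplicate (DecSetoid._≟_ orbitSetoid) Lc
    e-reps : Enumerates _∼_ (NormPerm s) reps
    e-reps = enumerates-deduplicate orbitSetoid Lc (Enumerates.sound e-Lc)
               (λ x x-cls → Any.map ≗⇒∼ (Enumerates.complete e-Lc x x-cls))
    orbit-size : ∀ {r} → NormPerm s r → HasSize tuples (λ x → NormPerm s x × r ∼ x) (length LK)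
    orbit-size {r} r-cls = map (λ k → scale k r) LK ,
      enumerates-map (≡.setoid (Fin n)) tuples (λ k → scale k r) (λ { refl → ≗-refl }) (scale-free r-cls)
        (λ k ik → NormPerm-scale k ik r-cls , ∼-intro k ik ≗-refl) (λ x (_ , r∼x) → ∼-elim r∼x) eK ,
      length-map (λ k → scale k r) LK

open import Data.Nat using (_*_; _/_)
open import Data.Nat.DivMod using (m*n/n≡m)
open import Data.Fin.Permutation using () renaming (id to idₚ)
open import Data.List using (_∷_)
open import Data.List.Relation.Unary.Any using (Any)
open import Data.Product using (_,_)
open import Relation.Binary.PropositionalEquality using (refl; sym; trans; cong; subst)
open Counting using (enumeration-size; HasSize-⇔)
open Permutations using (permSetoid)

index-of-product : ∀ {A : Set} {P : A → Set} N a (L : List A) → N ≡ a * length L → Any P L → index N (length L) ≡ a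
index-of-product N a (_ ∷ L) N≡a*|L| _ = trans (cong (_/ suc (length L)) N≡a*|L|) (m*n/n≡m a (suc (length L)))

lemma5p2 : (n : ℕ) .{{_ : NonZero n}} → Prime n → 5 ≤ n →
    let open ZMod n in
    (s : Tuple) → SumZero s → ¬ Constant s →
    (LK : List (Fin n)) → Enumerates _≡_ (InK s) LK →
    (Lγ : List Tuple) → Enumerates _≗_ (IsPermOf s) Lγ →
    (L′ : List (Permutation′ n)) → Enumerates _≈ₚ_ (InS′ s) L′ →
    (Lbar : List (Permutation′ n)) → Enumerates _≈ₚ_ (InSbar s) Lbar →
    (length LK ∣ index (n !) (length Lbar))
    × (¬ ClassOfId s →
        (length LK ∣ length Lγ)
        × (length Lγ ≡ index (n !) (length L′))
        × (index (n !) (length L′) ≡ index (n !) (length Lbar)))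
lemma5p2 0 _ ()
lemma5p2 (suc m) n-prime _ s _ nonconstant LK eK Lγ eγ L′ e′ Lbar ebar =
  K∣[𝔖:S̄] , λ not-id →
    let [𝔖:S′]≡[𝔖:S̄] = cong (index (n !)) (|S′|≡|S̄| not-id) in
    subst (length LK ∣_) (trans (sym [𝔖:S′]≡[𝔖:S̄]) [𝔖:S′]≡γ) K∣[𝔖:S̄] , sym [𝔖:S′]≡γ , [𝔖:S′]≡[𝔖:S̄]
  where
  open TupleActions m
  open Stabilisers m n-prime
  open KAction m n-prime s nonconstant eK
  [𝔖:S̄]≡#classes : index (n !) (length Lbar) ≡ length (classes s)
  [𝔖:S̄]≡#classes = index-of-product (n !) _ Lbar (n!≡#classes·|S̄| s ebar) (Enumerates.complete ebar idₚ (S′⊆S̄ s idₚ (λ _ → refl)))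
  [𝔖:S′]≡γ : index (n !) (length L′) ≡ length Lγ
  [𝔖:S′]≡γ = index-of-product (n !) _ L′ (n!≡γ·|S′| s eγ e′) (Enumerates.complete e′ idₚ (λ _ → refl))
  K∣[𝔖:S̄] : length LK ∣ index (n !) (length Lbar)
  K∣[𝔖:S̄] = subst (length LK ∣_) (sym [𝔖:S̄]≡#classes) (K-divides (classes-enumerates s))
  |S′|≡|S̄| : ¬ ClassOfId s → length L′ ≡ length Lbar
  |S′|≡|S̄| not-id = enumeration-size (permSetoid n)
    (HasSize-⇔ (permSetoid n) (S̄⊆S′ s not-id) (S′⊆S̄ s) (Lbar , ebar , refl)) e′
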